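{- Consider the surface defined over $\mathbb{Q}$ by $$4x^2 + (y^2 + 1 - z^2)^2 = 8y^2.$$ Every rational point $(x,y,z)$ on this surface either lies on one of the 8 lines $x = \varepsilon_1 y = \varepsilon_2 z + \varepsilon_3$ with $\varepsilon_1, \varepsilon_2, \varepsilon_3 \in \{+1,-1\}$ chosen independently, or else there exists a pair of rational numbers $b, c$ such that, writing $$D = b^2c^2 + 2b^2 - 3b^2c + c - bc^2 + 2b,$$ we have $$x = -\frac{b(c^2 + 2 - 4c)}{D}, \qquad y = -\frac{b(c^2 + 2 - 2c)}{D}, \qquad z = -\frac{b^2c^2 + 2b^2 - 3b^2c - c}{D}.$$ Conversely, these expressions satisfy the equation $4x^2 + (y^2 + 1 - z^2)^2 = 8y^2$ identically (as rational functions of $b, c$), and for such a point the parameters are recovered by $$b = \frac{y - x}{u - z - 1}, \qquad c = \frac{4x(y - x)}{(x - u)(y + x) + (u + 3x)(y - x)},$$ where $u$ is defined by $y^2 + 1 - z^2 = 2u$. -}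

module Defs where

open import Data.Rational using (ℚ; _+_; _*_; _-_; -_; _÷_; NonZero; 1ℚ; 0ℚ)
open import Data.Integer using (+_)
open import Data.Rational using (_/_)
open import Data.Sign using (Sign)
open import Data.Product using (∃; ∃-syntax; _×_)
open import Relation.Binary.PropositionalEquality using (_≡_)

2ℚ 3ℚ 4ℚ 8ℚ : ℚ
2ℚ = + 2 / 1
3ℚ = + 3 / 1
4ℚ = + 4 / 1
8ℚ = + 8 / 1

Surface : ℚ → ℚ → ℚ → Set
Surface x y z = 4ℚ * (x * x) + (y * y + 1ℚ - z * z) * (y * y + 1ℚ - z * z) ≡ 8ℚ * (y * y)

sgn : Sign → ℚ
sgn Sign.+ = 1ℚ
sgn Sign.- = - 1ℚ

OnLine : ℚ → ℚ → ℚ → Set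
OnLine x y z = ∃[ e₁ ] ∃[ e₂ ] ∃[ e₃ ]
  (x ≡ sgn e₁ * y × sgn e₁ * y ≡ sgn e₂ * z + sgn e₃)

D : ℚ → ℚ → ℚ
D b c = b * b * (c * c) + 2ℚ * (b * b) - 3ℚ * (b * b) * c + c - b * (c * c) + 2ℚ * b

xOf : (b c : ℚ) → .{{NonZero (D b c)}} → ℚ
xOf b c = (- (b * (c * c + 2ℚ - 4ℚ * c))) ÷ D b c

yOf : (b c : ℚ) → .{{NonZero (D b c)}} → ℚ
yOf b c = (- (b * (c * c + 2ℚ - 2ℚ * c))) ÷ D b c

zOf : (b c : ℚ) → .{{NonZero (D b c)}} → ℚ
zOf b c = (- (b * b * (c * c) + 2ℚ * (b * b) - 3ℚ * (b * b) * c - c)) ÷ D b c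

uOf : ℚ → ℚ → ℚ
uOf y z = (y * y + 1ℚ - z * z) ÷ 2ℚ

den-b : ℚ → ℚ → ℚ → ℚ
den-b x y z = uOf y z - z - 1ℚ

den-c : ℚ → ℚ → ℚ → ℚ
den-c x y z = (x - uOf y z) * (y + x) + (uOf y z + 3ℚ * x) * (y - x)

bOf : (x y z : ℚ) → .{{NonZero (den-b x y z)}} → ℚ
bOf x y z = (y - x) ÷ den-b x y z

cOf : (x y z : ℚ) → .{{NonZero (den-c x y z)}} → ℚ
cOf x y z = (4ℚ * x * (y - x)) ÷ den-c x y z

-- With 2u = y² + 1 − z² the surface is the conic x² + u² = 2y² in (x : y : u) together with this
-- relation for u. The conic passes through (1 : 1 : 1); the secant through it with parameter
-- c = 2(y − x)/(2y − x − u) meets it again at (x : y : u) = (c² + 2 − 4c : c² + 2 − 2c : c² − 2),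
-- and b = (y − x)/(u − z − 1) fixes the scale: the relation for u then forces (y − x)·D = −2bc.
-- These parameters are undefined only when x = y or u = z + 1, and such points lie on the eight
-- lines.

module Submission where

open import Defs
open import Data.Rational using (ℚ; NonZero)
open import Data.Product using (Σ; ∃₂; _×_)
open import Data.Sum using (_⊎_)
open import Relation.Binary.PropositionalEquality using (_≡_)

open import Data.List.Base using (_∷_; [])
open import Data.Product using (∃-syntax; _,_; proj₁; proj₂)
open import Data.Rational using (_+_; _*_; _-_; -_; _÷_; 1/_; ½; 0ℚ; 1ℚ; ≢-nonZero)
open import Data.Rational.Properties
  using (_≟_; +-*-commutativeRing; +-0-group; heytingCommutativeRing; neg-injective;
         *-assoc; *-comm; *-identityˡ; *-identityʳ; *-zeroˡ; *-zeroʳ; *-inverseˡ; *-inverseʳ)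
open import Algebra.Apartness.Properties.HeytingCommutativeRing heytingCommutativeRing
  using (x#0y#0→xy#0)
open import Algebra.Properties.Group +-0-group using (x∙y⁻¹≈ε⇒x≈y; x≈y⇒x∙y⁻¹≈ε; inverseˡ-unique)
open import Data.Sign using (Sign; opposite)
open import Data.Sum using (inj₁; inj₂; reduce)
open import Level using (0ℓ)
open import Relation.Binary.PropositionalEquality
  using (_≢_; refl; sym; trans; cong; cong₂; module ≡-Reasoning)
open import Relation.Nullary using (Dec; yes; no; contradiction)
open import Relation.Nullary.Decidable.Core using (dec⇒maybe)
open import Tactic.RingSolver using (solve; solve-∀)
open import Tactic.RingSolver.Core.AlmostCommutativeRing
  using (AlmostCommutativeRing; fromCommutativeRing)

open ≡-Reasoning

ℚ-ring : AlmostCommutativeRing 0ℓ 0ℓ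
ℚ-ring = fromCommutativeRing +-*-commutativeRing (λ p → dec⇒maybe (0ℚ ≟ p))

2ℚ≢0 : 2ℚ ≢ 0ℚ
2ℚ≢0 ()

4ℚ≢0 : 4ℚ ≢ 0ℚ
4ℚ≢0 ()

p*q≡r⇒p≡r÷q : ∀ p q r .{{_ : NonZero q}} → p * q ≡ r → p ≡ r ÷ q
p*q≡r⇒p≡r÷q p q _ refl = begin
  p              ≡⟨ *-identityʳ p ⟨
  p * 1ℚ         ≡⟨ cong (p *_) (*-inverseʳ q) ⟨
  p * (q * 1/ q) ≡⟨ *-assoc p q (1/ q) ⟨
  p * q * 1/ q   ∎

p÷q*q≡p : ∀ p q .{{_ : NonZero q}} → p ÷ q * q ≡ p
p÷q*q≡p p q = begin
  p * 1/ q * q   ≡⟨ *-assoc p (1/ q) q ⟩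
  p * (1/ q * q) ≡⟨ cong (p *_) (*-inverseˡ q) ⟩
  p * 1ℚ         ≡⟨ *-identityʳ p ⟩
  p              ∎

*-cancelˡ-≡ : ∀ r {p q} → r ≢ 0ℚ → r * p ≡ r * q → p ≡ q
*-cancelˡ-≡ r {p} {q} r≢0 rp≡rq =
  trans (p*q≡r⇒p≡r÷q p r _ (*-comm p r)) (sym (p*q≡r⇒p≡r÷q q r _ (trans (*-comm q r) (sym rp≡rq))))
  where instance _ = ≢-nonZero r≢0

p*q≡0⇒p≡0∨q≡0 : ∀ p q → p * q ≡ 0ℚ → p ≡ 0ℚ ⊎ q ≡ 0ℚ
p*q≡0⇒p≡0∨q≡0 p q pq≡0 with p ≟ 0ℚ | q ≟ 0ℚ
... | yes p≡0 | _       = inj₁ p≡0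
... | no _    | yes q≡0 = inj₂ q≡0
... | no p≢0  | no q≢0  = contradiction pq≡0 (x#0y#0→xy#0 p≢0 q≢0)

p*p≡q*q⇒p≡±q : ∀ p q → p * p ≡ q * q → ∃[ e ] p ≡ sgn e * q
p*p≡q*q⇒p≡±q p q p²≡q² = root (p*q≡0⇒p≡0∨q≡0 (p - q) (p + q) [p-q][p+q]≡0)
  where
  [p-q][p+q]≡0 : (p - q) * (p + q) ≡ 0ℚ
  [p-q][p+q]≡0 = begin
    (p - q) * (p + q) ≡⟨ solve (p ∷ q ∷ []) ℚ-ring ⟩
    p * p - q * q     ≡⟨ x≈y⇒x∙y⁻¹≈ε p²≡q² ⟩
    0ℚ                ∎
  -q≡-1*q : - q ≡ - 1ℚ * q
  -q≡-1*q = solve (q ∷ []) ℚ-ring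
  root : p - q ≡ 0ℚ ⊎ p + q ≡ 0ℚ → ∃[ e ] p ≡ sgn e * q
  root (inj₁ p-q≡0) = Sign.+ , trans (x∙y⁻¹≈ε⇒x≈y p q p-q≡0) (sym (*-identityˡ q))
  root (inj₂ p+q≡0) = Sign.- , trans (inverseˡ-unique p q p+q≡0) -q≡-1*q

sgn-squared : ∀ e → sgn e * sgn e ≡ 1ℚ
sgn-squared Sign.+ = refl
sgn-squared Sign.- = refl

sgn-opposite : ∀ e → sgn (opposite e) ≡ - sgn e
sgn-opposite Sign.+ = refl
sgn-opposite Sign.- = refl

2*uOf≡y²+1-z² : ∀ y z → 2ℚ * uOf y z ≡ y * y + 1ℚ - z * z
2*uOf≡y²+1-z² y z = trans (*-comm 2ℚ (uOf y z)) (p÷q*q≡p (y * y + 1ℚ - z * z) 2ℚ)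

uOf-unique : ∀ y z {u} → 2ℚ * u ≡ y * y + 1ℚ - z * z → uOf y z ≡ u
uOf-unique y z 2u≡w = *-cancelˡ-≡ 2ℚ 2ℚ≢0 (trans (2*uOf≡y²+1-z² y z) (sym 2u≡w))

surface⇒conic : ∀ x y z u → 2ℚ * u ≡ y * y + 1ℚ - z * z →
                Surface x y z → x * x + u * u ≡ 2ℚ * (y * y)
surface⇒conic x y z u 2u≡w surface = *-cancelˡ-≡ 4ℚ 4ℚ≢0 (begin
  4ℚ * (x * x + u * u)                                          ≡⟨ solve (x ∷ u ∷ []) ℚ-ring ⟩
  4ℚ * (x * x) + 2ℚ * u * (2ℚ * u)                              ≡⟨ cong (λ w → 4ℚ * (x * x) + w * w) 2u≡w ⟩
  4ℚ * (x * x) + (y * y + 1ℚ - z * z) * (y * y + 1ℚ - z * z)    ≡⟨ surface ⟩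
  8ℚ * (y * y)                                                  ≡⟨ solve (y ∷ []) ℚ-ring ⟩
  4ℚ * (2ℚ * (y * y))                                           ∎)

conic⇒surface : ∀ x y z u → 2ℚ * u ≡ y * y + 1ℚ - z * z →
                x * x + u * u ≡ 2ℚ * (y * y) → Surface x y z
conic⇒surface x y z u 2u≡w conic = begin
  4ℚ * (x * x) + (y * y + 1ℚ - z * z) * (y * y + 1ℚ - z * z)    ≡⟨ cong (λ w → 4ℚ * (x * x) + w * w) 2u≡w ⟨
  4ℚ * (x * x) + 2ℚ * u * (2ℚ * u)                              ≡⟨ solve (x ∷ u ∷ []) ℚ-ring ⟩
  4ℚ * (x * x + u * u)                                          ≡⟨ cong (4ℚ *_) conic ⟩
  4ℚ * (2ℚ * (y * y))                                           ≡⟨ solve (y ∷ []) ℚ-ring ⟩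
  8ℚ * (y * y)                                                  ∎

surface⇒conic-uOf : ∀ x y z → Surface x y z → x * x + uOf y z * uOf y z ≡ 2ℚ * (y * y)
surface⇒conic-uOf x y z = surface⇒conic x y z (uOf y z) (2*uOf≡y²+1-z² y z)

z≡ε[x-δ]⇒x≡εz+δ : ∀ x z ε δ → ε * ε ≡ 1ℚ → z ≡ ε * (x - δ) → x ≡ ε * z + δ
z≡ε[x-δ]⇒x≡εz+δ x z ε δ ε²≡1 z≡ε[x-δ] = sym (begin
  ε * z + δ              ≡⟨ cong (λ t → ε * t + δ) z≡ε[x-δ] ⟩
  ε * (ε * (x - δ)) + δ  ≡⟨ solve (x ∷ ε ∷ δ ∷ []) ℚ-ring ⟩
  ε * ε * (x - δ) + δ    ≡⟨ cong (λ k → k * (x - δ) + δ) ε²≡1 ⟩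
  1ℚ * (x - δ) + δ       ≡⟨ solve (x ∷ δ ∷ []) ℚ-ring ⟩
  x                      ∎)

diagonal⇒onLine : ∀ x z u → 2ℚ * u ≡ x * x + 1ℚ - z * z →
                  x * x + u * u ≡ 2ℚ * (x * x) → OnLine x x z
diagonal⇒onLine x z u 2u≡w conic = through (p*p≡q*q⇒p≡±q u x u²≡x²)
  where
  u²≡x² : u * u ≡ x * x
  u²≡x² = begin
    u * u                    ≡⟨ solve (x ∷ u ∷ []) ℚ-ring ⟩
    x * x + u * u - x * x    ≡⟨ cong (_- x * x) conic ⟩
    2ℚ * (x * x) - x * x     ≡⟨ solve (x ∷ []) ℚ-ring ⟩
    x * x                    ∎
  z²≡[x-ε]² : ∀ ε → ε * ε ≡ 1ℚ → u ≡ ε * x → z * z ≡ (x - ε) * (x - ε)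
  z²≡[x-ε]² ε ε²≡1 u≡εx = begin
    z * z                                ≡⟨ solve (x ∷ z ∷ []) ℚ-ring ⟩
    x * x + 1ℚ - (x * x + 1ℚ - z * z)    ≡⟨ cong (λ w → x * x + 1ℚ - w) 2u≡w ⟨
    x * x + 1ℚ - 2ℚ * u                  ≡⟨ cong₂ (λ k v → x * x + k - 2ℚ * v) (sym ε²≡1) u≡εx ⟩
    x * x + ε * ε - 2ℚ * (ε * x)         ≡⟨ solve (x ∷ ε ∷ []) ℚ-ring ⟩
    (x - ε) * (x - ε)                    ∎
  through : ∃[ σ ] u ≡ sgn σ * x → OnLine x x z
  through (σ , u≡σx) = line (p*p≡q*q⇒p≡±q z (x - sgn σ) (z²≡[x-ε]² (sgn σ) (sgn-squared σ) u≡σx))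
    where
    line : ∃[ τ ] z ≡ sgn τ * (x - sgn σ) → OnLine x x z
    line (τ , z≡τ[x-σ]) =
      Sign.+ , τ , σ , sym (*-identityˡ x)
      , trans (*-identityˡ x) (z≡ε[x-δ]⇒x≡εz+δ x z (sgn τ) (sgn σ) (sgn-squared τ) z≡τ[x-σ])

y≡ε[z+1]⇒-y≡-εz-ε : ∀ y z ε → y ≡ ε * (z + 1ℚ) → - 1ℚ * y ≡ - ε * z + - ε
y≡ε[z+1]⇒-y≡-εz-ε y z ε y≡ε[z+1] = begin
  - 1ℚ * y              ≡⟨ cong (- 1ℚ *_) y≡ε[z+1] ⟩
  - 1ℚ * (ε * (z + 1ℚ)) ≡⟨ solve (z ∷ ε ∷ []) ℚ-ring ⟩
  - ε * z + - ε         ∎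

u-z-1≡0⇒onLine : ∀ x y z u → x ≢ y → 2ℚ * u ≡ y * y + 1ℚ - z * z →
                 x * x + u * u ≡ 2ℚ * (y * y) → u - z - 1ℚ ≡ 0ℚ → OnLine x y z
u-z-1≡0⇒onLine x y z u x≢y 2u≡w conic Q≡0 = through (p*p≡q*q⇒p≡±q y (z + 1ℚ) y²≡[z+1]²)
  where
  u≡z+1 : u ≡ z + 1ℚ
  u≡z+1 = begin
    u                        ≡⟨ solve (z ∷ u ∷ []) ℚ-ring ⟩
    u - z - 1ℚ + (z + 1ℚ)    ≡⟨ cong (_+ (z + 1ℚ)) Q≡0 ⟩
    0ℚ + (z + 1ℚ)            ≡⟨ solve (z ∷ []) ℚ-ring ⟩
    z + 1ℚ                   ∎
  y²≡[z+1]² : y * y ≡ (z + 1ℚ) * (z + 1ℚ)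
  y²≡[z+1]² = begin
    y * y                              ≡⟨ solve (y ∷ z ∷ []) ℚ-ring ⟩
    y * y + 1ℚ - z * z + z * z - 1ℚ    ≡⟨ cong (λ w → w + z * z - 1ℚ) 2u≡w ⟨
    2ℚ * u + z * z - 1ℚ                ≡⟨ cong (λ v → 2ℚ * v + z * z - 1ℚ) u≡z+1 ⟩
    2ℚ * (z + 1ℚ) + z * z - 1ℚ         ≡⟨ solve (z ∷ []) ℚ-ring ⟩
    (z + 1ℚ) * (z + 1ℚ)                ∎
  x²≡y² : x * x ≡ y * y
  x²≡y² = begin
    x * x                                ≡⟨ solve (x ∷ u ∷ []) ℚ-ring ⟩
    x * x + u * u - u * u                ≡⟨ cong (_- u * u) conic ⟩
    2ℚ * (y * y) - u * u                 ≡⟨ cong (λ v → 2ℚ * (y * y) - v * v) u≡z+1 ⟩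
    2ℚ * (y * y) - (z + 1ℚ) * (z + 1ℚ)   ≡⟨ cong (λ t → 2ℚ * (y * y) - t) y²≡[z+1]² ⟨
    2ℚ * (y * y) - y * y                 ≡⟨ solve (y ∷ []) ℚ-ring ⟩
    y * y                                ∎
  through : ∃[ τ ] y ≡ sgn τ * (z + 1ℚ) → OnLine x y z
  through (τ , y≡τ[z+1]) = antidiagonal (p*p≡q*q⇒p≡±q x y x²≡y²)
    where
    antidiagonal : ∃[ e ] x ≡ sgn e * y → OnLine x y z
    antidiagonal (Sign.+ , x≡y) = contradiction (trans x≡y (*-identityˡ y)) x≢y
    antidiagonal (Sign.- , x≡-y) =
      Sign.- , opposite τ , opposite τ , x≡-y
      , trans (y≡ε[z+1]⇒-y≡-εz-ε y z (sgn τ) y≡τ[z+1]) (cong (λ k → k * z + k) (sym (sgn-opposite τ)))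

-- x + u = 2y is the tangent line to the conic at (1 : 1 : 1).
conic∧tangent⇒x≡y : ∀ x y u → x * x + u * u ≡ 2ℚ * (y * y) → 2ℚ * y - x - u ≡ 0ℚ → x ≡ y
conic∧tangent⇒x≡y x y u conic R≡0 =
  x∙y⁻¹≈ε⇒x≈y x y (reduce (p*q≡0⇒p≡0∨q≡0 (x - y) (x - y) [x-y]²≡0))
  where
  u≡2y-x : u ≡ 2ℚ * y - x
  u≡2y-x = begin
    u                               ≡⟨ solve (x ∷ y ∷ u ∷ []) ℚ-ring ⟩
    2ℚ * y - x - (2ℚ * y - x - u)   ≡⟨ cong (λ r → 2ℚ * y - x - r) R≡0 ⟩
    2ℚ * y - x - 0ℚ                 ≡⟨ solve (x ∷ y ∷ []) ℚ-ring ⟩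
    2ℚ * y - x                      ∎
  [x-y]²≡0 : (x - y) * (x - y) ≡ 0ℚ
  [x-y]²≡0 = begin
    (x - y) * (x - y)                                    ≡⟨ solve (x ∷ y ∷ []) ℚ-ring ⟩
    ½ * (x * x + (2ℚ * y - x) * (2ℚ * y - x)) - y * y    ≡⟨ cong (λ v → ½ * (x * x + v * v) - y * y) u≡2y-x ⟨
    ½ * (x * x + u * u) - y * y                          ≡⟨ cong (λ q → ½ * q - y * y) conic ⟩
    ½ * (2ℚ * (y * y)) - y * y                           ≡⟨ solve (y ∷ []) ℚ-ring ⟩
    0ℚ                                                   ∎

-- With s = y − x and t = y − u the conic reads s² + t² = 2y(s + t) and the secant c(s + t) = 2s;
-- multiplying the conic by c² leaves an equation divisible by s.
secant-point : ∀ x y u c → x * x + u * u ≡ 2ℚ * (y * y) →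
               c * (2ℚ * y - x - u) ≡ 2ℚ * (y - x) → y - x ≢ 0ℚ →
               2ℚ * c * x ≡ (y - x) * (c * c + 2ℚ - 4ℚ * c) ×
               2ℚ * c * y ≡ (y - x) * (c * c + 2ℚ - 2ℚ * c) ×
               2ℚ * c * u ≡ (y - x) * (c * c - 2ℚ)
secant-point x y u c conic cR≡2s s≢0 = 2cx , 2cy , 2cu
  where
  2cy : 2ℚ * c * y ≡ (y - x) * (c * c + 2ℚ - 2ℚ * c)
  2cy = *-cancelˡ-≡ (2ℚ * (y - x)) (x#0y#0→xy#0 2ℚ≢0 s≢0) (sym (begin
    2ℚ * (y - x) * ((y - x) * (c * c + 2ℚ - 2ℚ * c))
      ≡⟨ solve (x ∷ y ∷ c ∷ []) ℚ-ring ⟩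
    c * c * ((y - x) * (y - x)) + (2ℚ * (y - x) - c * (y - x)) * (2ℚ * (y - x) - c * (y - x))
      ≡⟨ cong (λ t → c * c * ((y - x) * (y - x)) + (t - c * (y - x)) * (t - c * (y - x))) cR≡2s ⟨
    c * c * ((y - x) * (y - x)) + (c * (2ℚ * y - x - u) - c * (y - x)) * (c * (2ℚ * y - x - u) - c * (y - x))
      ≡⟨ solve (x ∷ y ∷ u ∷ c ∷ []) ℚ-ring ⟩
    c * c * (x * x + u * u) - c * c * (2ℚ * (y * y)) + 2ℚ * c * y * (c * (2ℚ * y - x - u))
      ≡⟨ cong₂ (λ q r → c * c * q - c * c * (2ℚ * (y * y)) + 2ℚ * c * y * r) conic cR≡2s ⟩
    c * c * (2ℚ * (y * y)) - c * c * (2ℚ * (y * y)) + 2ℚ * c * y * (2ℚ * (y - x))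
      ≡⟨ solve (x ∷ y ∷ c ∷ []) ℚ-ring ⟩
    2ℚ * (y - x) * (2ℚ * c * y)
      ∎))
  2cx : 2ℚ * c * x ≡ (y - x) * (c * c + 2ℚ - 4ℚ * c)
  2cx = begin
    2ℚ * c * x                                             ≡⟨ solve (x ∷ y ∷ c ∷ []) ℚ-ring ⟩
    2ℚ * c * y - 2ℚ * c * (y - x)                          ≡⟨ cong (_- 2ℚ * c * (y - x)) 2cy ⟩
    (y - x) * (c * c + 2ℚ - 2ℚ * c) - 2ℚ * c * (y - x)     ≡⟨ solve (x ∷ y ∷ c ∷ []) ℚ-ring ⟩
    (y - x) * (c * c + 2ℚ - 4ℚ * c)                        ∎
  2cu : 2ℚ * c * u ≡ (y - x) * (c * c - 2ℚ)
  2cu = begin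
    2ℚ * c * u
      ≡⟨ solve (x ∷ y ∷ u ∷ c ∷ []) ℚ-ring ⟩
    2ℚ * (2ℚ * c * y) - 2ℚ * c * x - 2ℚ * (c * (2ℚ * y - x - u))
      ≡⟨ cong₂ (λ p q → 2ℚ * p - q - 2ℚ * (c * (2ℚ * y - x - u))) 2cy 2cx ⟩
    2ℚ * ((y - x) * (c * c + 2ℚ - 2ℚ * c)) - (y - x) * (c * c + 2ℚ - 4ℚ * c) - 2ℚ * (c * (2ℚ * y - x - u))
      ≡⟨ cong (λ r → 2ℚ * ((y - x) * (c * c + 2ℚ - 2ℚ * c)) - (y - x) * (c * c + 2ℚ - 4ℚ * c) - 2ℚ * r)
              cR≡2s ⟩
    2ℚ * ((y - x) * (c * c + 2ℚ - 2ℚ * c)) - (y - x) * (c * c + 2ℚ - 4ℚ * c) - 2ℚ * (2ℚ * (y - x))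
      ≡⟨ solve (x ∷ y ∷ c ∷ []) ℚ-ring ⟩
    (y - x) * (c * c - 2ℚ)
      ∎

-- Rewritten through the secant point and b(u − z − 1) = y − x, the relation for u becomes
-- 4c(y − x)((y − x)D + 2bc) = 0.
s*D≡-2bc : ∀ b c s y z u → c ≢ 0ℚ → s ≢ 0ℚ →
           2ℚ * u ≡ y * y + 1ℚ - z * z → b * (u - z - 1ℚ) ≡ s →
           2ℚ * c * y ≡ s * (c * c + 2ℚ - 2ℚ * c) → 2ℚ * c * u ≡ s * (c * c - 2ℚ) →
           s * D b c ≡ - (2ℚ * b * c)
s*D≡-2bc b c s y z u c≢0 s≢0 2u≡w bQ≡s 2cy 2cu =
  inverseˡ-unique (s * D b c) (2ℚ * b * c) (*-cancelˡ-≡ (4ℚ * c * s) 4cs≢0 (begin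
    4ℚ * c * s * (s * (b * b * (c * c) + 2ℚ * (b * b) - 3ℚ * (b * b) * c + c - b * (c * c) + 2ℚ * b) + 2ℚ * b * c)
      ≡⟨ solve (b ∷ c ∷ s ∷ []) ℚ-ring ⟩
    - (b * b * (s * (c * c + 2ℚ - 2ℚ * c) * (s * (c * c + 2ℚ - 2ℚ * c)))
       - (b * (s * (c * c - 2ℚ)) - 2ℚ * c * s) * (b * (s * (c * c - 2ℚ)) - 2ℚ * c * s) - 8ℚ * (c * c) * b * s)
      ≡⟨ cong₂ (λ Y U → - (b * b * (Y * Y) - (b * U - 2ℚ * c * s) * (b * U - 2ℚ * c * s) - 8ℚ * (c * c) * b * s))
               2cy 2cu ⟨
    - (b * b * (2ℚ * c * y * (2ℚ * c * y))
       - (b * (2ℚ * c * u) - 2ℚ * c * s) * (b * (2ℚ * c * u) - 2ℚ * c * s) - 8ℚ * (c * c) * b * s)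
      ≡⟨ cong (λ t → - (b * b * (2ℚ * c * y * (2ℚ * c * y))
                        - (b * (2ℚ * c * u) - 2ℚ * c * t) * (b * (2ℚ * c * u) - 2ℚ * c * t) - 8ℚ * (c * c) * b * t))
              bQ≡s ⟨
    - (b * b * (2ℚ * c * y * (2ℚ * c * y))
       - (b * (2ℚ * c * u) - 2ℚ * c * (b * (u - z - 1ℚ))) * (b * (2ℚ * c * u) - 2ℚ * c * (b * (u - z - 1ℚ)))
       - 8ℚ * (c * c) * b * (b * (u - z - 1ℚ)))
      ≡⟨ solve (b ∷ c ∷ y ∷ z ∷ u ∷ []) ℚ-ring ⟩
    4ℚ * (c * c) * (b * b) * (2ℚ * u - (y * y + 1ℚ - z * z))
      ≡⟨ cong (λ w → 4ℚ * (c * c) * (b * b) * (w - (y * y + 1ℚ - z * z))) 2u≡w ⟩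
    4ℚ * (c * c) * (b * b) * (y * y + 1ℚ - z * z - (y * y + 1ℚ - z * z))
      ≡⟨ solve (b ∷ c ∷ s ∷ y ∷ z ∷ []) ℚ-ring ⟩
    4ℚ * c * s * 0ℚ
      ∎))
  where
  4cs≢0 : 4ℚ * c * s ≢ 0ℚ
  4cs≢0 = x#0y#0→xy#0 (x#0y#0→xy#0 4ℚ≢0 c≢0) s≢0

scale-by-denominator : ∀ b c s d v p → c ≢ 0ℚ → s ≢ 0ℚ →
                       2ℚ * c * v ≡ s * p → s * d ≡ - (2ℚ * b * c) → v * d ≡ - (b * p)
scale-by-denominator b c s d v p c≢0 s≢0 2cv≡sp sd≡-2bc =
  *-cancelˡ-≡ (2ℚ * c * s) (x#0y#0→xy#0 (x#0y#0→xy#0 2ℚ≢0 c≢0) s≢0) (begin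
    2ℚ * c * s * (v * d)       ≡⟨ solve (c ∷ s ∷ d ∷ v ∷ []) ℚ-ring ⟩
    2ℚ * c * v * (s * d)       ≡⟨ cong₂ _*_ 2cv≡sp sd≡-2bc ⟩
    s * p * - (2ℚ * b * c)     ≡⟨ solve (b ∷ c ∷ s ∷ p ∷ []) ℚ-ring ⟩
    2ℚ * c * s * - (b * p)     ∎)

z-coordinate : ∀ b x y z u d X Y Z U → b ≢ 0ℚ → b * (u - z - 1ℚ) ≡ y - x →
               x * d ≡ X → y * d ≡ Y → u * d ≡ U → b * (U - Z - d) ≡ Y - X → z * d ≡ Z
z-coordinate b x y z u d X Y Z U b≢0 bQ≡s xd≡X yd≡Y ud≡U recovery =
  *-cancelˡ-≡ b b≢0 (begin
    b * (z * d)                                  ≡⟨ solve (b ∷ z ∷ u ∷ d ∷ []) ℚ-ring ⟩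
    b * (u * d) - b * d - b * (u - z - 1ℚ) * d   ≡⟨ cong (λ t → b * (u * d) - b * d - t * d) bQ≡s ⟩
    b * (u * d) - b * d - (y - x) * d            ≡⟨ solve (b ∷ x ∷ y ∷ u ∷ d ∷ []) ℚ-ring ⟩
    b * (u * d) - b * d - (y * d - x * d)        ≡⟨ cong (λ t → b * t - b * d - (y * d - x * d)) ud≡U ⟩
    b * U - b * d - (y * d - x * d)              ≡⟨ cong₂ (λ p q → b * U - b * d - (p - q)) yd≡Y xd≡X ⟩
    b * U - b * d - (Y - X)                      ≡⟨ cong (λ t → b * U - b * d - t) recovery ⟨
    b * U - b * d - b * (U - Z - d)              ≡⟨ solve (b ∷ d ∷ Z ∷ U ∷ []) ℚ-ring ⟩
    b * Z                                        ∎)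

-- xOf, yOf and zOf are these numerators divided by D; uNum / D is uOf at the parametrised point.
xNum yNum zNum uNum : ℚ → ℚ → ℚ
xNum b c = - (b * (c * c + 2ℚ - 4ℚ * c))
yNum b c = - (b * (c * c + 2ℚ - 2ℚ * c))
zNum b c = - (b * b * (c * c) + 2ℚ * (b * b) - 3ℚ * (b * b) * c - c)
uNum b c = - (b * (c * c - 2ℚ))

-- The ring solver reads goals syntactically, so these identities spell the polynomials out.
conic-identity : ∀ b c →
  let X = - (b * (c * c + 2ℚ - 4ℚ * c))
      Y = - (b * (c * c + 2ℚ - 2ℚ * c))
      U = - (b * (c * c - 2ℚ))
  in X * X + U * U ≡ 2ℚ * (Y * Y)
conic-identity = solve-∀ ℚ-ring

quadric-identity : ∀ b c →
  let Y = - (b * (c * c + 2ℚ - 2ℚ * c))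
      Z = - (b * b * (c * c) + 2ℚ * (b * b) - 3ℚ * (b * b) * c - c)
      U = - (b * (c * c - 2ℚ))
      D = b * b * (c * c) + 2ℚ * (b * b) - 3ℚ * (b * b) * c + c - b * (c * c) + 2ℚ * b
  in Y * Y + D * D - Z * Z ≡ 2ℚ * U * D
quadric-identity = solve-∀ ℚ-ring

b-recovery-identity : ∀ b c →
  let X = - (b * (c * c + 2ℚ - 4ℚ * c))
      Y = - (b * (c * c + 2ℚ - 2ℚ * c))
      Z = - (b * b * (c * c) + 2ℚ * (b * b) - 3ℚ * (b * b) * c - c)
      U = - (b * (c * c - 2ℚ))
      D = b * b * (c * c) + 2ℚ * (b * b) - 3ℚ * (b * b) * c + c - b * (c * c) + 2ℚ * b
  in b * (U - Z - D) ≡ Y - X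
b-recovery-identity = solve-∀ ℚ-ring

c-recovery-identity : ∀ b c i →
  let X = - (b * (c * c + 2ℚ - 4ℚ * c)) * i
      Y = - (b * (c * c + 2ℚ - 2ℚ * c)) * i
      U = - (b * (c * c - 2ℚ)) * i
  in c * ((X - U) * (Y + X) + (U + 3ℚ * X) * (Y - X)) ≡ 4ℚ * X * (Y - X)
c-recovery-identity = solve-∀ ℚ-ring

parameters⇒coordinates :
  ∀ x y z u b c → 2ℚ * u ≡ y * y + 1ℚ - z * z → x * x + u * u ≡ 2ℚ * (y * y) → y - x ≢ 0ℚ →
  b * (u - z - 1ℚ) ≡ y - x → c * (2ℚ * y - x - u) ≡ 2ℚ * (y - x) →
  Σ (NonZero (D b c)) λ nz → (x ≡ xOf b c {{nz}} × y ≡ yOf b c {{nz}} × z ≡ zOf b c {{nz}})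
parameters⇒coordinates x y z u b c 2u≡w conic s≢0 bQ≡s cR≡2s =
  nz , p*q≡r⇒p≡r÷q x (D b c) _ xD , p*q≡r⇒p≡r÷q y (D b c) _ yD , p*q≡r⇒p≡r÷q z (D b c) _ zD
  where
  b≢0 : b ≢ 0ℚ
  b≢0 b≡0 = s≢0 (trans (sym bQ≡s) (trans (cong (_* (u - z - 1ℚ)) b≡0) (*-zeroˡ (u - z - 1ℚ))))
  c≢0 : c ≢ 0ℚ
  c≢0 c≡0 = x#0y#0→xy#0 2ℚ≢0 s≢0
    (trans (sym cR≡2s) (trans (cong (_* (2ℚ * y - x - u)) c≡0) (*-zeroˡ (2ℚ * y - x - u))))
  2cx : 2ℚ * c * x ≡ (y - x) * (c * c + 2ℚ - 4ℚ * c)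
  2cx = proj₁ (secant-point x y u c conic cR≡2s s≢0)
  2cy : 2ℚ * c * y ≡ (y - x) * (c * c + 2ℚ - 2ℚ * c)
  2cy = proj₁ (proj₂ (secant-point x y u c conic cR≡2s s≢0))
  2cu : 2ℚ * c * u ≡ (y - x) * (c * c - 2ℚ)
  2cu = proj₂ (proj₂ (secant-point x y u c conic cR≡2s s≢0))
  sD≡-2bc : (y - x) * D b c ≡ - (2ℚ * b * c)
  sD≡-2bc = s*D≡-2bc b c (y - x) y z u c≢0 s≢0 2u≡w bQ≡s 2cy 2cu
  D≢0 : D b c ≢ 0ℚ
  D≢0 D≡0 = x#0y#0→xy#0 (x#0y#0→xy#0 2ℚ≢0 b≢0) c≢0
    (neg-injective (trans (sym sD≡-2bc) (trans (cong ((y - x) *_) D≡0) (*-zeroʳ (y - x)))))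
  xD : x * D b c ≡ xNum b c
  xD = scale-by-denominator b c (y - x) (D b c) x _ c≢0 s≢0 2cx sD≡-2bc
  yD : y * D b c ≡ yNum b c
  yD = scale-by-denominator b c (y - x) (D b c) y _ c≢0 s≢0 2cy sD≡-2bc
  uD : u * D b c ≡ uNum b c
  uD = scale-by-denominator b c (y - x) (D b c) u _ c≢0 s≢0 2cu sD≡-2bc
  zD : z * D b c ≡ zNum b c
  zD = z-coordinate b x y z u (D b c) (xNum b c) (yNum b c) (zNum b c) (uNum b c)
         b≢0 bQ≡s xD yD uD (b-recovery-identity b c)
  instance
    nz : NonZero (D b c)
    nz = ≢-nonZero D≢0

generic-point⇒parametrised :
  ∀ x y z → Surface x y z → x ≢ y → den-b x y z ≢ 0ℚ →
  ∃₂ λ b c → Σ (NonZero (D b c)) λ nz → (x ≡ xOf b c {{nz}} × y ≡ yOf b c {{nz}} × z ≡ zOf b c {{nz}})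
generic-point⇒parametrised x y z surface x≢y Q≢0 =
  b , c , parameters⇒coordinates x y z (uOf y z) b c (2*uOf≡y²+1-z² y z) conic s≢0
            (p÷q*q≡p (y - x) (den-b x y z)) (p÷q*q≡p (2ℚ * (y - x)) (2ℚ * y - x - uOf y z))
  where
  conic : x * x + uOf y z * uOf y z ≡ 2ℚ * (y * y)
  conic = surface⇒conic-uOf x y z surface
  s≢0 : y - x ≢ 0ℚ
  s≢0 s≡0 = x≢y (sym (x∙y⁻¹≈ε⇒x≈y y x s≡0))
  R≢0 : 2ℚ * y - x - uOf y z ≢ 0ℚ
  R≢0 R≡0 = x≢y (conic∧tangent⇒x≡y x y (uOf y z) conic R≡0)
  instance
    _ = ≢-nonZero Q≢0
    _ = ≢-nonZero R≢0
  -- This c agrees with cOf x y z, since den-c x y z = 2x(2y − x − u), but needs no x ≠ 0.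
  b c : ℚ
  b = (y - x) ÷ den-b x y z
  c = 2ℚ * (y - x) ÷ (2ℚ * y - x - uOf y z)

surface-point-cases : ∀ x y z → Surface x y z → Dec (x ≡ y) → Dec (den-b x y z ≡ 0ℚ) →
  OnLine x y z ⊎
  ∃₂ λ b c → Σ (NonZero (D b c)) λ nz → (x ≡ xOf b c {{nz}} × y ≡ yOf b c {{nz}} × z ≡ zOf b c {{nz}})
surface-point-cases x _ z surface (yes refl) _ =
  inj₁ (diagonal⇒onLine x z (uOf x z) (2*uOf≡y²+1-z² x z) (surface⇒conic-uOf x x z surface))
surface-point-cases x y z surface (no x≢y) (yes Q≡0) =
  inj₁ (u-z-1≡0⇒onLine x y z (uOf y z) x≢y (2*uOf≡y²+1-z² y z) (surface⇒conic-uOf x y z surface) Q≡0)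
surface-point-cases x y z surface (no x≢y) (no Q≢0) =
  inj₂ (generic-point⇒parametrised x y z surface x≢y Q≢0)

dehomogenise-conic : ∀ X Y U i → X * X + U * U ≡ 2ℚ * (Y * Y) →
                     X * i * (X * i) + U * i * (U * i) ≡ 2ℚ * (Y * i * (Y * i))
dehomogenise-conic X Y U i conic = begin
  X * i * (X * i) + U * i * (U * i)   ≡⟨ solve (X ∷ U ∷ i ∷ []) ℚ-ring ⟩
  (X * X + U * U) * (i * i)           ≡⟨ cong (_* (i * i)) conic ⟩
  2ℚ * (Y * Y) * (i * i)              ≡⟨ solve (Y ∷ i ∷ []) ℚ-ring ⟩
  2ℚ * (Y * i * (Y * i))              ∎

dehomogenise-quadric : ∀ Y Z U d i → d * i ≡ 1ℚ → Y * Y + d * d - Z * Z ≡ 2ℚ * U * d →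
                       2ℚ * (U * i) ≡ Y * i * (Y * i) + 1ℚ - Z * i * (Z * i)
dehomogenise-quadric Y Z U d i di≡1 quadric = sym (begin
  Y * i * (Y * i) + 1ℚ - Z * i * (Z * i)
    ≡⟨ cong (λ t → Y * i * (Y * i) + t - Z * i * (Z * i)) (cong₂ _*_ di≡1 di≡1) ⟨
  Y * i * (Y * i) + d * i * (d * i) - Z * i * (Z * i)  ≡⟨ solve (Y ∷ Z ∷ d ∷ i ∷ []) ℚ-ring ⟩
  (Y * Y + d * d - Z * Z) * (i * i)                    ≡⟨ cong (_* (i * i)) quadric ⟩
  2ℚ * U * d * (i * i)                                 ≡⟨ solve (U ∷ d ∷ i ∷ []) ℚ-ring ⟩
  2ℚ * (U * i) * (d * i)                               ≡⟨ cong (2ℚ * (U * i) *_) di≡1 ⟩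
  2ℚ * (U * i) * 1ℚ                                    ≡⟨ *-identityʳ (2ℚ * (U * i)) ⟩
  2ℚ * (U * i)                                         ∎)

dehomogenise-b-recovery : ∀ b X Y Z U d i → d * i ≡ 1ℚ → b * (U - Z - d) ≡ Y - X →
                          b * (U * i - Z * i - 1ℚ) ≡ Y * i - X * i
dehomogenise-b-recovery b X Y Z U d i di≡1 recovery = begin
  b * (U * i - Z * i - 1ℚ)     ≡⟨ cong (λ t → b * (U * i - Z * i - t)) di≡1 ⟨
  b * (U * i - Z * i - d * i)  ≡⟨ solve (b ∷ Z ∷ U ∷ d ∷ i ∷ []) ℚ-ring ⟩
  b * (U - Z - d) * i          ≡⟨ cong (_* i) recovery ⟩
  (Y - X) * i                  ≡⟨ solve (X ∷ Y ∷ i ∷ []) ℚ-ring ⟩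
  Y * i - X * i                ∎

module _ (b c : ℚ) .{{_ : NonZero (D b c)}} where

  2*uParametrisation : 2ℚ * (uNum b c * 1/ D b c) ≡ yOf b c * yOf b c + 1ℚ - zOf b c * zOf b c
  2*uParametrisation = dehomogenise-quadric (yNum b c) (zNum b c) (uNum b c) (D b c) (1/ D b c)
    (*-inverseʳ (D b c)) (quadric-identity b c)

  uOf-parametrisation : uOf (yOf b c) (zOf b c) ≡ uNum b c * 1/ D b c
  uOf-parametrisation = uOf-unique (yOf b c) (zOf b c) 2*uParametrisation

  parametrisation-on-surface : Surface (xOf b c) (yOf b c) (zOf b c)
  parametrisation-on-surface =
    conic⇒surface (xOf b c) (yOf b c) (zOf b c) (uNum b c * 1/ D b c) 2*uParametrisation
      (dehomogenise-conic (xNum b c) (yNum b c) (uNum b c) (1/ D b c) (conic-identity b c))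

  parameters-recovered :
    {{_ : NonZero (den-b (xOf b c) (yOf b c) (zOf b c))}} →
    {{_ : NonZero (den-c (xOf b c) (yOf b c) (zOf b c))}} →
    b ≡ bOf (xOf b c) (yOf b c) (zOf b c) × c ≡ cOf (xOf b c) (yOf b c) (zOf b c)
  parameters-recovered = p*q≡r⇒p≡r÷q b _ _ b-eq , p*q≡r⇒p≡r÷q c _ _ c-eq
    where
    x y z : ℚ
    x = xOf b c
    y = yOf b c
    z = zOf b c
    b-eq : b * den-b x y z ≡ y - x
    b-eq = trans (cong (λ u → b * (u - z - 1ℚ)) uOf-parametrisation)
      (dehomogenise-b-recovery b (xNum b c) (yNum b c) (zNum b c) (uNum b c) (D b c) (1/ D b c)
        (*-inverseʳ (D b c)) (b-recovery-identity b c))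
    c-eq : c * den-c x y z ≡ 4ℚ * x * (y - x)
    c-eq = trans (cong (λ u → c * ((x - u) * (y + x) + (u + 3ℚ * x) * (y - x))) uOf-parametrisation)
      (c-recovery-identity b c (1/ D b c))

theorem2p1 :
    ((x y z : ℚ) → Surface x y z →
      OnLine x y z ⊎
      ∃₂ λ b c → Σ (NonZero (D b c)) λ nz →
        (x ≡ xOf b c {{nz}} × y ≡ yOf b c {{nz}} × z ≡ zOf b c {{nz}}))
    ×
    ((b c : ℚ) → .{{nz : NonZero (D b c)}} →
      Surface (xOf b c) (yOf b c) (zOf b c))
    ×
    ((b c : ℚ) → .{{nz : NonZero (D b c)}} →
      {{nb : NonZero (den-b (xOf b c) (yOf b c) (zOf b c))}} →
      {{nc : NonZero (den-c (xOf b c) (yOf b c) (zOf b c))}} →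
      (b ≡ bOf (xOf b c) (yOf b c) (zOf b c) × c ≡ cOf (xOf b c) (yOf b c) (zOf b c)))
theorem2p1 =
  (λ x y z surface → surface-point-cases x y z surface (x ≟ y) (den-b x y z ≟ 0ℚ)) ,
  parametrisation-on-surface ,
  parameters-recovered
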